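{- For all finite types $\sigma,\tau$: $\mathsf{HE}\text{ - }\mathsf{HA}^\omega\vdash\forall^{\mathrm{Ext}}f,g:\sigma\to\tau\;\forall^{\mathrm{Ext}}x,y:\sigma\,(x=_\sigma y\wedge f=_{\sigma\to\tau}g\to fx=_\tau gy)$.
   Context: Finite types are generated by: $0$ is a type; if $\sigma,\tau$ are types, so are $\sigma\times\tau$ and $\sigma\to\tau$. $\mathsf{HA}^\omega$ is the many-sorted intuitionistic first-order theory whose sorts are the finite types. Its terms are built from variables and, for all types $\rho,\sigma,\tau$, the constants $\mathsf{k}:\rho\to\sigma\to\rho$, $\mathsf{s}:(\rho\to\sigma\to\tau)\to(\rho\to\sigma)\to(\rho\to\tau)$, $\mathsf{pair}:\sigma\to\tau\to\sigma\times\tau$, $\mathsf{fst}:\sigma\times\tau\to\sigma$, $\mathsf{snd}:\sigma\times\tau\to\tau$, $0:0$, $S:0\to0$, $\mathsf{R}:\sigma\to(0\to\sigma\to\sigma)\to0\to\sigma$, by application (associating to the left). Atomic formulas are $\bot$ and $s\equiv_\sigma t$. Axioms: $\equiv_\sigma$ is an equivalence relation; $x\equiv x'\to y\equiv y'\to xy\equiv x'y'$; $\mathsf{k}xy\equiv x$; $\mathsf{s}xyz\equiv xz(yz)$; $\mathsf{fst}(\mathsf{pair}\,xy)\equiv x$; $\mathsf{snd}(\mathsf{pair}\,xy)\equiv y$; $\mathsf{R}xy0\equiv x$; $\mathsf{R}xy(Sm)\equiv ym(\mathsf{R}xym)$; $Sx\equiv_0Sy\to x\equiv_0y$; $\neg(Sx\equiv_00)$;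 induction for all formulas. $\mathsf{H}\text{ - }\mathsf{HA}^\omega$ extends the language with, for each type $\sigma$, a unary predicate $\mathrm{Ext}_\sigma$ and a binary predicate $=_\sigma$; $\forall^{\mathrm{Ext}}x:\sigma.\psi$ abbreviates $\forall x:\sigma(\mathrm{Ext}_\sigma(x)\to\psi)$. Its axioms are those of $\mathsf{HA}^\omega$, induction for all formulas of the extended language, and for all $\sigma,\tau$: $x=_0y\leftrightarrow x\equiv_0y$; $\forall x:0\,\mathrm{Ext}_0(x)$; $x=_{\sigma\times\tau}y\leftrightarrow(\mathsf{fst}\,x=_\sigma\mathsf{fst}\,y\wedge\mathsf{snd}\,x=_\tau\mathsf{snd}\,y)$; $\mathrm{Ext}_{\sigma\times\tau}(x)\leftrightarrow(\mathrm{Ext}_\sigma(\mathsf{fst}\,x)\wedge\mathrm{Ext}_\tau(\mathsf{snd}\,x))$; $f=_{\sigma\to\tau}g\leftrightarrow\forall^{\mathrm{Ext}}x:\sigma.fx=_\tau gx$; $\mathrm{Ext}_{\sigma\to\tau}(f)\to\mathrm{Ext}_\sigma(x)\to\mathrm{Ext}_\tau(fx)$; $x\equiv_\sigma y\to\mathrm{Ext}_\sigma(x)\to\mathrm{Ext}_\sigma(y)$; $\mathrm{Ext}(c)$ for each constant $c$. $\mathsf{HE}\text{ - }\mathsf{HA}^\omega$ is $\mathsf{H}\text{ - }\mathsf{HA}^\omega$ plus, for all $\sigma,\tau$, the axiom $\mathrm{Ext}_{\sigma\to\tau}(f)\to\mathrm{Ext}_\sigma(x)\to\mathrm{Ext}_\sigma(y)\to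 x=_\sigma y\to fx=_\tau fy$. -}

module Defs where

open import Data.List using (List; []; _∷_; map)
open import Data.List.Membership.Propositional using (_∈_)

infixr 7 _⇒_
infixr 8 _⊗_

data Ty : Set where
  ι   : Ty
  _⊗_ : Ty → Ty → Ty
  _⇒_ : Ty → Ty → Ty

Ctx : Set
Ctx = List Ty

data _∋_ : Ctx → Ty → Set where
  here  : ∀ {Γ σ} → (σ ∷ Γ) ∋ σ
  there : ∀ {Γ σ τ} → Γ ∋ σ → (τ ∷ Γ) ∋ σ

infixl 9 _·_

data Tm (Γ : Ctx) : Ty → Set where
  var  : ∀ {σ} → Γ ∋ σ → Tm Γ σ
  _·_  : ∀ {σ τ} → Tm Γ (σ ⇒ τ) → Tm Γ σ → Tm Γ τ
  𝗸    : ∀ {ρ σ} → Tm Γ (ρ ⇒ σ ⇒ ρ)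
  𝘀    : ∀ {ρ σ τ} → Tm Γ ((ρ ⇒ σ ⇒ τ) ⇒ (ρ ⇒ σ) ⇒ (ρ ⇒ τ))
  pair : ∀ {σ τ} → Tm Γ (σ ⇒ τ ⇒ σ ⊗ τ)
  fst  : ∀ {σ τ} → Tm Γ (σ ⊗ τ ⇒ σ)
  snd  : ∀ {σ τ} → Tm Γ (σ ⊗ τ ⇒ τ)
  𝟎    : Tm Γ ι
  𝐒    : Tm Γ (ι ⇒ ι)
  𝐑    : ∀ {σ} → Tm Γ (σ ⇒ (ι ⇒ σ ⇒ σ) ⇒ ι ⇒ σ)

infix  6 _≡'_ _≐_
infixr 5 _∧'_
infixr 4 _∨'_
infixr 3 _⊃_ _⇔'_

data Fm (Γ : Ctx) : Set where
  ⊥'   : Fm Γ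
  _≡'_ : ∀ {σ} → Tm Γ σ → Tm Γ σ → Fm Γ     -- intensional equality ≡_σ
  Ext  : ∀ σ → Tm Γ σ → Fm Γ
  _≐_  : ∀ {σ} → Tm Γ σ → Tm Γ σ → Fm Γ     -- extensional equality =_σ
  _∧'_ : Fm Γ → Fm Γ → Fm Γ
  _∨'_ : Fm Γ → Fm Γ → Fm Γ
  _⊃_  : Fm Γ → Fm Γ → Fm Γ
  ∀'   : ∀ σ → Fm (σ ∷ Γ) → Fm Γ
  ∃'   : ∀ σ → Fm (σ ∷ Γ) → Fm Γ

¬' : ∀ {Γ} → Fm Γ → Fm Γ
¬' φ = φ ⊃ ⊥'

_⇔'_ : ∀ {Γ} → Fm Γ → Fm Γ → Fm Γ
φ ⇔' ψ = (φ ⊃ ψ) ∧' (ψ ⊃ φ)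

∀Ext : ∀ {Γ} σ → Fm (σ ∷ Γ) → Fm Γ
∀Ext σ φ = ∀' σ (Ext σ (var here) ⊃ φ)

Ren : Ctx → Ctx → Set
Ren Γ Δ = ∀ {σ} → Γ ∋ σ → Δ ∋ σ

extR : ∀ {Γ Δ τ} → Ren Γ Δ → Ren (τ ∷ Γ) (τ ∷ Δ)
extR r here      = here
extR r (there x) = there (r x)

renTm : ∀ {Γ Δ σ} → Ren Γ Δ → Tm Γ σ → Tm Δ σ
renTm r (var x) = var (r x)
renTm r (t · u) = renTm r t · renTm r u
renTm r 𝗸 = 𝗸
renTm r 𝘀 = 𝘀
renTm r pair = pair
renTm r fst = fst
renTm r snd = snd
renTm r 𝟎 = 𝟎
renTm r 𝐒 = 𝐒
renTm r 𝐑 = 𝐑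

renFm : ∀ {Γ Δ} → Ren Γ Δ → Fm Γ → Fm Δ
renFm r ⊥' = ⊥'
renFm r (s ≡' t) = renTm r s ≡' renTm r t
renFm r (Ext σ t) = Ext σ (renTm r t)
renFm r (s ≐ t) = renTm r s ≐ renTm r t
renFm r (φ ∧' ψ) = renFm r φ ∧' renFm r ψ
renFm r (φ ∨' ψ) = renFm r φ ∨' renFm r ψ
renFm r (φ ⊃ ψ) = renFm r φ ⊃ renFm r ψ
renFm r (∀' σ φ) = ∀' σ (renFm (extR r) φ)
renFm r (∃' σ φ) = ∃' σ (renFm (extR r) φ)

wkTm : ∀ {Γ σ τ} → Tm Γ σ → Tm (τ ∷ Γ) σ
wkTm = renTm there

wkFm : ∀ {Γ τ} → Fm Γ → Fm (τ ∷ Γ)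
wkFm = renFm there

Sub : Ctx → Ctx → Set
Sub Γ Δ = ∀ {σ} → Γ ∋ σ → Tm Δ σ

extS : ∀ {Γ Δ τ} → Sub Γ Δ → Sub (τ ∷ Γ) (τ ∷ Δ)
extS s here      = var here
extS s (there x) = wkTm (s x)

subTm : ∀ {Γ Δ σ} → Sub Γ Δ → Tm Γ σ → Tm Δ σ
subTm s (var x) = s x
subTm s (t · u) = subTm s t · subTm s u
subTm s 𝗸 = 𝗸
subTm s 𝘀 = 𝘀
subTm s pair = pair
subTm s fst = fst
subTm s snd = snd
subTm s 𝟎 = 𝟎
subTm s 𝐒 = 𝐒
subTm s 𝐑 = 𝐑

subFm : ∀ {Γ Δ} → Sub Γ Δ → Fm Γ → Fm Δ
subFm s ⊥' = ⊥'
subFm s (a ≡' b) = subTm s a ≡' subTm s b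
subFm s (Ext σ t) = Ext σ (subTm s t)
subFm s (a ≐ b) = subTm s a ≐ subTm s b
subFm s (φ ∧' ψ) = subFm s φ ∧' subFm s ψ
subFm s (φ ∨' ψ) = subFm s φ ∨' subFm s ψ
subFm s (φ ⊃ ψ) = subFm s φ ⊃ subFm s ψ
subFm s (∀' σ φ) = ∀' σ (subFm (extS s) φ)
subFm s (∃' σ φ) = ∃' σ (subFm (extS s) φ)

sub0 : ∀ {Γ σ} → Tm Γ σ → Sub (σ ∷ Γ) Γ
sub0 t here      = t
sub0 t (there x) = var x

_[_] : ∀ {Γ σ} → Fm (σ ∷ Γ) → Tm Γ σ → Fm Γ
φ [ t ] = subFm (sub0 t) φ

subSucc : ∀ {Γ} → Sub (ι ∷ Γ) (ι ∷ Γ)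
subSucc here      = 𝐒 · var here
subSucc (there x) = var (there x)

Axioms : Set₁
Axioms = ∀ {Γ} → Fm Γ → Set

data Deriv (Ax : Axioms) : (Γ : Ctx) → List (Fm Γ) → Fm Γ → Set where
  hyp  : ∀ {Γ Δ φ} → φ ∈ Δ → Deriv Ax Γ Δ φ
  ax   : ∀ {Γ Δ φ} → Ax φ → Deriv Ax Γ Δ φ
  ⊥E   : ∀ {Γ Δ φ} → Deriv Ax Γ Δ ⊥' → Deriv Ax Γ Δ φ
  ⊃I   : ∀ {Γ Δ φ ψ} → Deriv Ax Γ (φ ∷ Δ) ψ → Deriv Ax Γ Δ (φ ⊃ ψ)
  ⊃E   : ∀ {Γ Δ φ ψ} → Deriv Ax Γ Δ (φ ⊃ ψ) → Deriv Ax Γ Δ φ → Deriv Ax Γ Δ ψ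
  ∧I   : ∀ {Γ Δ φ ψ} → Deriv Ax Γ Δ φ → Deriv Ax Γ Δ ψ → Deriv Ax Γ Δ (φ ∧' ψ)
  ∧E₁  : ∀ {Γ Δ φ ψ} → Deriv Ax Γ Δ (φ ∧' ψ) → Deriv Ax Γ Δ φ
  ∧E₂  : ∀ {Γ Δ φ ψ} → Deriv Ax Γ Δ (φ ∧' ψ) → Deriv Ax Γ Δ ψ
  ∨I₁  : ∀ {Γ Δ φ ψ} → Deriv Ax Γ Δ φ → Deriv Ax Γ Δ (φ ∨' ψ)
  ∨I₂  : ∀ {Γ Δ φ ψ} → Deriv Ax Γ Δ ψ → Deriv Ax Γ Δ (φ ∨' ψ)
  ∨E   : ∀ {Γ Δ φ ψ χ} → Deriv Ax Γ Δ (φ ∨' ψ) → Deriv Ax Γ (φ ∷ Δ) χ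
         → Deriv Ax Γ (ψ ∷ Δ) χ → Deriv Ax Γ Δ χ
  ∀I   : ∀ {Γ Δ σ φ} → Deriv Ax (σ ∷ Γ) (map wkFm Δ) φ → Deriv Ax Γ Δ (∀' σ φ)
  ∀E   : ∀ {Γ Δ σ φ} → Deriv Ax Γ Δ (∀' σ φ) → (t : Tm Γ σ) → Deriv Ax Γ Δ (φ [ t ])
  ∃I   : ∀ {Γ Δ σ φ} → (t : Tm Γ σ) → Deriv Ax Γ Δ (φ [ t ]) → Deriv Ax Γ Δ (∃' σ φ)
  ∃E   : ∀ {Γ Δ σ φ ψ} → Deriv Ax Γ Δ (∃' σ φ)
         → Deriv Ax (σ ∷ Γ) (φ ∷ map wkFm Δ) (wkFm ψ) → Deriv Ax Γ Δ ψ

-- Axioms with free variables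
-- are given as schemata over arbitrary terms (equivalent to their
-- universal closures).

data AxH : Axioms where
  ≡-refl  : ∀ {Γ σ} (x : Tm Γ σ) → AxH (x ≡' x)
  ≡-sym   : ∀ {Γ σ} (x y : Tm Γ σ) → AxH (x ≡' y ⊃ y ≡' x)
  ≡-trans : ∀ {Γ σ} (x y z : Tm Γ σ) → AxH (x ≡' y ⊃ y ≡' z ⊃ x ≡' z)
  ≡-app   : ∀ {Γ σ τ} (x x' : Tm Γ (σ ⇒ τ)) (y y' : Tm Γ σ)
            → AxH (x ≡' x' ⊃ y ≡' y' ⊃ (x · y) ≡' (x' · y'))
  ax-k    : ∀ {Γ ρ σ} (x : Tm Γ ρ) (y : Tm Γ σ) → AxH ((𝗸 · x · y) ≡' x)
  ax-s    : ∀ {Γ ρ σ τ} (x : Tm Γ (ρ ⇒ σ ⇒ τ)) (y : Tm Γ (ρ ⇒ σ)) (z : Tm Γ ρ)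
            → AxH ((𝘀 · x · y · z) ≡' (x · z · (y · z)))
  ax-fst  : ∀ {Γ σ τ} (x : Tm Γ σ) (y : Tm Γ τ) → AxH ((fst · (pair · x · y)) ≡' x)
  ax-snd  : ∀ {Γ σ τ} (x : Tm Γ σ) (y : Tm Γ τ) → AxH ((snd · (pair · x · y)) ≡' y)
  ax-R0   : ∀ {Γ σ} (x : Tm Γ σ) (y : Tm Γ (ι ⇒ σ ⇒ σ)) → AxH ((𝐑 · x · y · 𝟎) ≡' x)
  ax-RS   : ∀ {Γ σ} (x : Tm Γ σ) (y : Tm Γ (ι ⇒ σ ⇒ σ)) (m : Tm Γ ι)
            → AxH ((𝐑 · x · y · (𝐒 · m)) ≡' (y · m · (𝐑 · x · y · m)))
  ax-Sinj : ∀ {Γ} (x y : Tm Γ ι) → AxH ((𝐒 · x) ≡' (𝐒 · y) ⊃ x ≡' y)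
  ax-S≠0  : ∀ {Γ} (x : Tm Γ ι) → AxH (¬' ((𝐒 · x) ≡' 𝟎))
  ax-ind  : ∀ {Γ} (φ : Fm (ι ∷ Γ))
            → AxH (φ [ 𝟎 ] ⊃ ∀' ι (φ ⊃ subFm subSucc φ) ⊃ ∀' ι φ)
  eq-0    : ∀ {Γ} (x y : Tm Γ ι) → AxH (x ≐ y ⇔' x ≡' y)
  Ext-0   : ∀ {Γ} (x : Tm Γ ι) → AxH (Ext ι x)
  eq-×    : ∀ {Γ σ τ} (x y : Tm Γ (σ ⊗ τ))
            → AxH (x ≐ y ⇔' ((fst · x) ≐ (fst · y) ∧' (snd · x) ≐ (snd · y)))
  Ext-×   : ∀ {Γ σ τ} (x : Tm Γ (σ ⊗ τ))
            → AxH (Ext (σ ⊗ τ) x ⇔' (Ext σ (fst · x) ∧' Ext τ (snd · x)))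
  eq-⇒    : ∀ {Γ σ τ} (f g : Tm Γ (σ ⇒ τ))
            → AxH (f ≐ g ⇔' ∀Ext σ ((wkTm f · var here) ≐ (wkTm g · var here)))
  Ext-app : ∀ {Γ σ τ} (f : Tm Γ (σ ⇒ τ)) (x : Tm Γ σ)
            → AxH (Ext (σ ⇒ τ) f ⊃ Ext σ x ⊃ Ext τ (f · x))
  Ext-≡   : ∀ {Γ σ} (x y : Tm Γ σ) → AxH (x ≡' y ⊃ Ext σ x ⊃ Ext σ y)
  Ext-k    : ∀ {Γ ρ σ} → AxH {Γ} (Ext (ρ ⇒ σ ⇒ ρ) 𝗸)
  Ext-s    : ∀ {Γ ρ σ τ} → AxH {Γ} (Ext ((ρ ⇒ σ ⇒ τ) ⇒ (ρ ⇒ σ) ⇒ (ρ ⇒ τ)) 𝘀)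
  Ext-pair : ∀ {Γ σ τ} → AxH {Γ} (Ext (σ ⇒ τ ⇒ σ ⊗ τ) pair)
  Ext-fst  : ∀ {Γ σ τ} → AxH {Γ} (Ext (σ ⊗ τ ⇒ σ) fst)
  Ext-snd  : ∀ {Γ σ τ} → AxH {Γ} (Ext (σ ⊗ τ ⇒ τ) snd)
  Ext-𝟎    : ∀ {Γ} → AxH {Γ} (Ext ι 𝟎)
  Ext-𝐒    : ∀ {Γ} → AxH {Γ} (Ext (ι ⇒ ι) 𝐒)
  Ext-𝐑    : ∀ {Γ σ} → AxH {Γ} (Ext (σ ⇒ (ι ⇒ σ ⇒ σ) ⇒ ι ⇒ σ) 𝐑)

data AxHE : Axioms where
  fromH : ∀ {Γ} {φ : Fm Γ} → AxH φ → AxHE φ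
  ext   : ∀ {Γ σ τ} (f : Tm Γ (σ ⇒ τ)) (x y : Tm Γ σ)
          → AxHE (Ext (σ ⇒ τ) f ⊃ Ext σ x ⊃ Ext σ y ⊃ x ≐ y ⊃ (f · x) ≐ (f · y))

HE-HAω⊢_ : Fm [] → Set
HE-HAω⊢ φ = Deriv AxHE [] [] φ

v0 : ∀ {Γ σ} → Tm (σ ∷ Γ) σ
v0 = var here
v1 : ∀ {Γ σ τ} → Tm (τ ∷ σ ∷ Γ) σ
v1 = var (there here)
v2 : ∀ {Γ σ τ ρ} → Tm (ρ ∷ τ ∷ σ ∷ Γ) σ
v2 = var (there (there here))
v3 : ∀ {Γ σ τ ρ υ} → Tm (υ ∷ ρ ∷ τ ∷ σ ∷ Γ) σ
v3 = var (there (there (there here)))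

{-# OPTIONS --safe #-}
-- f x = f y is the extensionality axiom of HE-HAω and f y = g y unfolds the
-- definition of = at function type; the two are chained by transitivity of =,
-- which H-HAω proves at each type by induction on the type.
module Submission where

open import Defs
open import Data.List using (List; _∷_)
open import Data.List.Relation.Unary.Any using (here; there)
open import Relation.Binary.PropositionalEquality using (_≡_; refl; trans; cong₂; subst)

subTm-renTm : ∀ {Γ Δ Θ σ} (s : Sub Δ Θ) (r : Ren Γ Δ) (a : Tm Γ σ) →
              subTm s (renTm r a) ≡ subTm (λ x → s (r x)) a
subTm-renTm s r (var x) = refl
subTm-renTm s r (t · u) = cong₂ _·_ (subTm-renTm s r t) (subTm-renTm s r u)
subTm-renTm s r 𝗸    = refl
subTm-renTm s r 𝘀    = refl
subTm-renTm s r pair = refl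
subTm-renTm s r fst  = refl
subTm-renTm s r snd  = refl
subTm-renTm s r 𝟎    = refl
subTm-renTm s r 𝐒    = refl
subTm-renTm s r 𝐑    = refl

subTm-var : ∀ {Γ σ} (a : Tm Γ σ) → subTm var a ≡ a
subTm-var (var x) = refl
subTm-var (t · u) = cong₂ _·_ (subTm-var t) (subTm-var u)
subTm-var 𝗸    = refl
subTm-var 𝘀    = refl
subTm-var pair = refl
subTm-var fst  = refl
subTm-var snd  = refl
subTm-var 𝟎    = refl
subTm-var 𝐒    = refl
subTm-var 𝐑    = refl

sub0-wkTm : ∀ {Γ σ τ} (t : Tm Γ σ) (a : Tm Γ τ) → subTm (sub0 t) (wkTm a) ≡ a
sub0-wkTm t a = trans (subTm-renTm (sub0 t) there a) (subTm-var a)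

infix 2 _∣_⊢_

_∣_⊢_ : (Γ : Ctx) → List (Fm Γ) → Fm Γ → Set
Γ ∣ Δ ⊢ φ = Deriv AxHE Γ Δ φ

axH : ∀ {Γ Δ} {φ : Fm Γ} → AxH φ → Γ ∣ Δ ⊢ φ
axH a = ax (fromH a)

⇔E→ : ∀ {Γ Δ} {φ ψ : Fm Γ} → Γ ∣ Δ ⊢ φ ⇔' ψ → Γ ∣ Δ ⊢ φ → Γ ∣ Δ ⊢ ψ
⇔E→ p = ⊃E (∧E₁ p)

⇔E← : ∀ {Γ Δ} {φ ψ : Fm Γ} → Γ ∣ Δ ⊢ φ ⇔' ψ → Γ ∣ Δ ⊢ ψ → Γ ∣ Δ ⊢ φ
⇔E← p = ⊃E (∧E₂ p)

≐-app : ∀ {Γ Δ σ τ} {f g : Tm Γ (σ ⇒ τ)} {x : Tm Γ σ} →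
        Γ ∣ Δ ⊢ f ≐ g → Γ ∣ Δ ⊢ Ext σ x → Γ ∣ Δ ⊢ f · x ≐ g · x
≐-app {Γ} {Δ} {σ} {f = f} {g} {x} f≐g ext-x =
  ⊃E (subst (λ φ → Γ ∣ Δ ⊢ φ)
            (cong₂ (λ f' g' → Ext σ x ⊃ f' · x ≐ g' · x) (sub0-wkTm x f) (sub0-wkTm x g))
            (∀E (⇔E→ (axH (eq-⇒ f g)) f≐g) x))
     ext-x

≐-cong-app : ∀ {Γ Δ σ τ} {f : Tm Γ (σ ⇒ τ)} {x y : Tm Γ σ} →
             Γ ∣ Δ ⊢ Ext (σ ⇒ τ) f → Γ ∣ Δ ⊢ Ext σ x → Γ ∣ Δ ⊢ Ext σ y →
             Γ ∣ Δ ⊢ x ≐ y → Γ ∣ Δ ⊢ f · x ≐ f · y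
≐-cong-app {f = f} {x} {y} ext-f ext-x ext-y x≐y =
  ⊃E (⊃E (⊃E (⊃E (ax (ext f x y)) ext-f) ext-x) ext-y) x≐y

-- Stated as an implication so that, in the function case, the hypotheses
-- survive the ∀-introduction as weakened assumptions.
≐-trans-⊃ : ∀ τ {Γ Δ} (a b c : Tm Γ τ) → Γ ∣ Δ ⊢ a ≐ b ⊃ b ≐ c ⊃ a ≐ c

≐-trans : ∀ {τ Γ Δ} {a b c : Tm Γ τ} → Γ ∣ Δ ⊢ a ≐ b → Γ ∣ Δ ⊢ b ≐ c → Γ ∣ Δ ⊢ a ≐ c
≐-trans {τ} {a = a} {b} {c} a≐b b≐c = ⊃E (⊃E (≐-trans-⊃ τ a b c) a≐b) b≐c

≐-trans-⊃ ι a b c = ⊃I (⊃I (⇔E← (axH (eq-0 a c))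
  (⊃E (⊃E (axH (≡-trans a b c))
          (⇔E→ (axH (eq-0 a b)) (hyp (there (here refl)))))
      (⇔E→ (axH (eq-0 b c)) (hyp (here refl))))))
≐-trans-⊃ (σ ⊗ τ) a b c = ⊃I (⊃I (⇔E← (axH (eq-× a c))
  (∧I (≐-trans (∧E₁ a≐b) (∧E₁ b≐c)) (≐-trans (∧E₂ a≐b) (∧E₂ b≐c)))))
  where
  a≐b = ⇔E→ (axH (eq-× a b)) (hyp (there (here refl)))
  b≐c = ⇔E→ (axH (eq-× b c)) (hyp (here refl))
≐-trans-⊃ (σ ⇒ τ) a b c = ⊃I (⊃I (⇔E← (axH (eq-⇒ a c)) (∀I (⊃I
  (≐-trans (≐-app (hyp (there (there (here refl)))) ext-v0)
           (≐-app (hyp (there (here refl))) ext-v0))))))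
  where
  ext-v0 = hyp (here refl)

lemma4p2 : (σ τ : Ty) →
    HE-HAω⊢ ∀Ext (σ ⇒ τ) (∀Ext (σ ⇒ τ) (∀Ext σ (∀Ext σ
    ((v1 ≐ v0 ∧' v3 ≐ v2) ⊃ (v3 · v1) ≐ (v2 · v0)))))
lemma4p2 σ τ = ∀I (⊃I (∀I (⊃I (∀I (⊃I (∀I (⊃I (⊃I
  (≐-trans (≐-cong-app ext-f ext-x ext-y (∧E₁ x≐y∧f≐g))
           (≐-app (∧E₂ x≐y∧f≐g) ext-y))))))))))
  where
  x≐y∧f≐g = hyp (here refl)
  ext-y   = hyp (there (here refl))
  ext-x   = hyp (there (there (here refl)))
  ext-f   = hyp (there (there (there (there (here refl)))))
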